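{- Every finite distributive lattice $\mathcal{L}=(L,\leq)$ has the intersection property, i.e. for all $x,y\in L$ there is $z\in L$ with $\Psi(x)\cap\Psi(y)=\Psi(z)$. Consequently, the core label order $\mathrm{CLO}(\mathcal{L})$ is a meet-semilattice, and it is a lattice if and only if $\mathcal{L}$ is isomorphic to a Boolean lattice.
   Context: Finite distributive lattices are congruence uniform. For a finite congruence-uniform lattice: an element $j$ is join-irreducible if $j=x\vee y$ implies $j\in\{x,y\}$, and then $j$ has a unique lower cover $j_*$. Cover relations $x\lessdot y$ and $u\lessdot v$ are perspective if either ($v\vee x=y$ and $v\wedge x=u$) or ($u\vee y=v$ and $u\wedge y=x$). For each cover relation $x\lessdot y$ there is a unique join-irreducible $j$ with $(x,y)$ and $(j_*,j)$ perspective; write $\gamma(x,y)=j$. The nucleus of $x$ is $x_\downarrow=\bigwedge_{y\lessdot x}y$ (with $x_\downarrow=x$ if $x$ has no lower cover), and $\Psi(x)=\{\gamma(u,v)\mid x_\downarrow\le u\lessdot v\le x\}$. The core label order $\mathrm{CLO}(\mathcal{L})$ is $L$ ordered by $x\sqsubseteq y$ iff $\Psi(x)\subseteq\Psi(y)$. A Boolean lattice is a lattice isomorphic to the power set of a finite set ordered by inclusion. -}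

module Defs where

open import Level using (Level; _⊔_)
open import Data.Nat using (ℕ)
open import Data.Fin using (Fin)
open import Data.Fin.Subset using (Subset; _⊆_)
open import Data.Product using (Σ; ∃; _×_)
open import Data.Sum using (_⊎_)
open import Relation.Nullary using (¬_)
open import Data.Empty using (⊥)
open import Relation.Binary.Core using (Rel)
open import Relation.Binary.PropositionalEquality using (_≡_)
open import Algebra.Core using (Op₂)
open import Function.Definitions using (Injective; Surjective)
open import Relation.Binary.Lattice.Bundles using (DistributiveLattice)
open import Relation.Binary.Lattice.Structures using (IsMeetSemilattice; IsLattice)
open import Relation.Binary.Morphism.Structures using (IsOrderIsomorphism)

module _ {c ℓ₁ ℓ₂ : Level} (𝓛 : DistributiveLattice c ℓ₁ ℓ₂) where
  open DistributiveLattice 𝓛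

  IsFinite : Set (c ⊔ ℓ₁)
  IsFinite = Σ ℕ λ n → Σ (Fin n → Carrier) λ e →
               Injective _≡_ _≈_ e × Surjective _≡_ _≈_ e

  _<ₗ_ : Rel Carrier (ℓ₁ ⊔ ℓ₂)
  x <ₗ y = x ≤ y × ¬ (x ≈ y)

  _⋖_ : Rel Carrier (c ⊔ ℓ₁ ⊔ ℓ₂)
  x ⋖ y = x <ₗ y × (∀ z → x <ₗ z → z <ₗ y → ⊥)

  IsJoinIrreducible : Carrier → Set (c ⊔ ℓ₁ ⊔ ℓ₂)
  IsJoinIrreducible j = ¬ (∀ x → j ≤ x) × (∀ x y → j ≈ x ∨ y → j ≈ x ⊎ j ≈ y)

  Perspective : Carrier → Carrier → Carrier → Carrier → Set ℓ₁
  Perspective x y u v = (v ∨ x ≈ y × v ∧ x ≈ u) ⊎ (u ∨ y ≈ v × u ∧ y ≈ x)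

  Label : Carrier → Carrier → Carrier → Set (c ⊔ ℓ₁ ⊔ ℓ₂)
  Label u v j = IsJoinIrreducible j × Σ Carrier λ j* → j* ⋖ j × Perspective u v j* j

  -- z is the nucleus x↓ of x: the meet of x together with all lower covers of x
  -- (so z = x when x has no lower cover)
  IsNucleus : Carrier → Carrier → Set (c ⊔ ℓ₁ ⊔ ℓ₂)
  IsNucleus x z = z ≤ x × (∀ y → y ⋖ x → z ≤ y)
                × (∀ w → w ≤ x → (∀ y → y ⋖ x → w ≤ y) → w ≤ z)

  Ψ : Carrier → Carrier → Set (c ⊔ ℓ₁ ⊔ ℓ₂)
  Ψ x j = Σ Carrier λ z → IsNucleus x z × Σ Carrier λ u → Σ Carrier λ v →
            z ≤ u × u ⋖ v × v ≤ x × Label u v j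

  _⊑_ : Rel Carrier (c ⊔ ℓ₁ ⊔ ℓ₂)
  x ⊑ y = ∀ j → Ψ x j → Ψ y j

  IntersectionProperty : Set (c ⊔ ℓ₁ ⊔ ℓ₂)
  IntersectionProperty = ∀ x y → Σ Carrier λ z → ∀ j →
    ((Ψ x j × Ψ y j) → Ψ z j) × (Ψ z j → (Ψ x j × Ψ y j))

  CLOIsMeetSemilattice : Set (c ⊔ ℓ₁ ⊔ ℓ₂)
  CLOIsMeetSemilattice = Σ (Op₂ Carrier) λ _⊓_ → IsMeetSemilattice _≈_ _⊑_ _⊓_

  CLOIsLattice : Set (c ⊔ ℓ₁ ⊔ ℓ₂)
  CLOIsLattice = Σ (Op₂ Carrier) λ _⊔'_ → Σ (Op₂ Carrier) λ _⊓_ →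
                   IsLattice _≈_ _⊑_ _⊔'_ _⊓_

  IsBoolean : Set (c ⊔ ℓ₁ ⊔ ℓ₂)
  IsBoolean = Σ ℕ λ k → Σ (Carrier → Subset k) λ f →
                IsOrderIsomorphism _≈_ _≡_ _≤_ _⊆_ f

module Submission where

-- In a finite distributive lattice the core labels of x are exactly the maximal join-irreducibles
-- below x. A label j of a cover u ⋖ v ≤ x lies below v but not below u. If some join-irreducible
-- k ≰ j had j ≤ k ≤ x, then for each lower cover y ≱ j of x we would get y ∨ j = x, so k ≤ y by
-- join-primality and j ≤ y after all; thus j would lie below the nucleus, which is below u.
-- Conversely a maximal j below x labels the cover (⋁{y ≤ x | j ≰ y}) ⋖ x. So Ψ x ∩ Ψ y = Ψ z
-- for z the join of the common maximal join-irreducibles, and Ψ x ⊆ Ψ y forces x ≤ y since every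
-- element is the join of the join-irreducibles below it. If the core label order has joins, comparable join-irreducibles a ≤ b
-- are both maximal below a ⊔ b, so the join-irreducibles form an antichain; then the core label
-- order is ≤ itself and x ↦ {join-irreducibles below x} is an isomorphism onto a power set.
-- Conversely, in a power set every join-irreducible is an atom.

open import Level using (Level)
open import Data.Empty using (⊥-elim)
open import Data.Fin as Fin using (Fin; zero; suc)
open import Data.Nat using (ℕ)
open import Data.Fin.Properties using (any?)
open import Data.Fin.Induction using (po-wellFounded; po-noetherian)
open import Data.Fin.Subset as Subset using (Subset; _⊆_; _∩_; ∁)
open import Data.Fin.Subset.Properties
  using (_∈?_; ⊆-antisym; ⊆-reflexive; x∈p∩q⁺; x∈p∩q⁻; x∉p⇒x∈∁p; x∈∁p⇒x∉p)
open import Data.List using (List; []; _∷_; foldr; filter; tabulate; lookup; length; map; allFin)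
open import Data.List.Membership.Propositional using (_∈_)
open import Data.List.Membership.Propositional.Properties
  using (∈-filter⁺; ∈-filter⁻; ∈-tabulate⁺; ∈-lookup; ∈-allFin; ∈-map∘filter⁺; ∈-map∘filter⁻)
open import Data.List.Relation.Unary.All as All using ()
open import Data.List.Relation.Unary.Any using (here; there; index)
open import Data.List.Relation.Unary.Any.Properties using (lookup-index)
open import Data.List.Relation.Unary.AllPairs using (_∷_)
open import Data.List.Relation.Unary.Unique.Setoid using (Unique)
import Data.List.Relation.Unary.Unique.Setoid.Properties as Unique
open import Data.Product using (∃; ∃-syntax; _×_; _,_; proj₁; proj₂)
open import Data.Sum using (_⊎_; inj₁; inj₂; [_,_]) renaming (map to ⊎-map)
import Data.Vec as Vec
open import Data.Vec.Properties using (lookup∘tabulate; []=⇒lookup; lookup⇒[]=)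
open import Function using (_∘_; flip)
open import Function.Bundles using (_⇔_; mk⇔)
open import Induction.WellFounded using (WellFounded; module All; module Subrelation)
open import Relation.Binary.Bundles using (Setoid)
open import Relation.Binary.Core using (Rel)
open import Relation.Binary.Definitions using (Decidable; Minimum; _Respects_)
open import Relation.Binary.Structures using (IsPartialOrder)
open import Relation.Binary.Lattice.Bundles using (DistributiveLattice)
open import Relation.Binary.Lattice.Structures using (IsLattice)
open import Relation.Binary.Morphism.Structures using (IsOrderIsomorphism)
import Relation.Binary.Construct.On as On
import Relation.Binary.Lattice.Properties.JoinSemilattice as JoinSemilatticeProperties
import Relation.Binary.Properties.Poset as PosetProperties
open import Relation.Binary.PropositionalEquality as ≡ using (_≡_)
open import Relation.Nullary using (¬_; Dec; yes; no; does; ¬?)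
open import Relation.Nullary.Decidable using (map′; _×-dec_; decidable-stable; dec-true; dec-false)
open import Relation.Nullary.Negation using (contradiction)
open import Relation.Unary using (Pred) renaming (Decidable to Decidable₁)
open import Defs using (IsFinite; IntersectionProperty; CLOIsMeetSemilattice; CLOIsLattice; IsBoolean)
import Defs as D

module _ {a ℓ} (S : Setoid a ℓ) where
  open Setoid S using (_≈_; sym)

  lookup-injective : ∀ {xs} → Unique S xs → ∀ {i j} → lookup xs i ≈ lookup xs j → i ≡ j
  lookup-injective (_ ∷ _) {zero} {zero} _ = ≡.refl
  lookup-injective (x≉xs ∷ _) {zero} {suc j} x≈y = ⊥-elim (All.lookup x≉xs (∈-lookup j) x≈y)
  lookup-injective (x≉xs ∷ _) {suc i} {zero} y≈x = ⊥-elim (All.lookup x≉xs (∈-lookup i) (sym y≈x))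
  lookup-injective (_ ∷ xs!) {suc i} {suc j} eq = ≡.cong suc (lookup-injective xs! eq)

module DistributiveLatticeProperties {c ℓ₁ ℓ₂} (𝓛 : DistributiveLattice c ℓ₁ ℓ₂) where
  open DistributiveLattice 𝓛
  open PosetProperties poset using (_<_; <⇒≉; <⇒≱; ≤∧≉⇒<; <-respˡ-≈; <-resp-≈; ≰-respʳ-≈)

  IsJoinIrreducible : Pred Carrier _
  IsJoinIrreducible = D.IsJoinIrreducible 𝓛

  infix 4 _⋖_ _⊑_
  _⋖_ : Rel Carrier _
  _⋖_ = D._⋖_ 𝓛

  Ψ : Carrier → Pred Carrier _
  Ψ = D.Ψ 𝓛

  _⊑_ : Rel Carrier _
  _⊑_ = D._⊑_ 𝓛

  private
    variable
      p : Level
      P : Pred Carrier p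
      a b j j* u v w x y : Carrier
      ys : List Carrier

  joinIrreducible-resp-≈ : IsJoinIrreducible Respects _≈_
  joinIrreducible-resp-≈ j≈k (j≱ , j-irr) =
    (λ k≤ → j≱ (trans (reflexive j≈k) ∘ k≤)) ,
    λ a b k≈a∨b → ⊎-map (Eq.trans (Eq.sym j≈k)) (Eq.trans (Eq.sym j≈k)) (j-irr a b (Eq.trans j≈k k≈a∨b))

  joinIrreducible-prime : IsJoinIrreducible j → j ≤ a ∨ b → j ≤ a ⊎ j ≤ b
  joinIrreducible-prime {j} {a} {b} (_ , j-irr) j≤a∨b
    with j-irr (j ∧ a) (j ∧ b) (Eq.trans (antisym (∧-greatest refl j≤a∨b) (x∧y≤x j _)) (∧-distribˡ-∨ j a b))
  ... | inj₁ j≈j∧a = inj₁ (trans (reflexive j≈j∧a) (x∧y≤y j a))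
  ... | inj₂ j≈j∧b = inj₂ (trans (reflexive j≈j∧b) (x∧y≤y j b))

  ⋖-resp-≈ˡ : (_⋖ x) Respects _≈_
  ⋖-resp-≈ˡ y≈z (y<x , nothing-between) =
    <-respˡ-≈ y≈z y<x , λ w z<w w<x → nothing-between w (<-respˡ-≈ (Eq.sym y≈z) z<w) w<x

  perspective⇒≤∧≰ : j* < j → IsJoinIrreducible j → D.Perspective 𝓛 u v j* j → j ≤ v × ¬ j ≤ u
  perspective⇒≤∧≰ {j*} {j} {u} j*<j _ (inj₁ (j∨u≈v , j∧u≈j*)) =
    trans (x≤x∨y j u) (reflexive j∨u≈v) ,
    λ j≤u → <⇒≱ j*<j (trans (∧-greatest refl j≤u) (reflexive j∧u≈j*))
  perspective⇒≤∧≰ {j*} {j} {u} {v} j*<j (_ , j-irr) (inj₂ (j*∨v≈j , j*∧v≈u))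
    with j-irr j* v (Eq.sym j*∨v≈j)
  ... | inj₁ j≈j* = ⊥-elim (<⇒≉ j*<j (Eq.sym j≈j*))
  ... | inj₂ j≈v =
    reflexive j≈v , λ j≤u → <⇒≱ j*<j (trans j≤u (trans (reflexive (Eq.sym j*∧v≈u)) (x∧y≤x j* v)))

  ⋀ : Carrier → List Carrier → Carrier
  ⋀ = foldr _∧_

  ⋀-≤ : ∀ x ys → ⋀ x ys ≤ x
  ⋀-≤ x [] = refl
  ⋀-≤ x (y ∷ ys) = trans (x∧y≤y y _) (⋀-≤ x ys)

  ⋀-lowerBound : ∀ x → y ∈ ys → ⋀ x ys ≤ y
  ⋀-lowerBound x (here ≡.refl) = x∧y≤x _ _
  ⋀-lowerBound x (there y∈ys) = trans (x∧y≤y _ _) (⋀-lowerBound x y∈ys)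

  ⋀-greatest : ∀ ys → w ≤ x → (∀ {y} → y ∈ ys → w ≤ y) → w ≤ ⋀ x ys
  ⋀-greatest [] w≤x _ = w≤x
  ⋀-greatest (y ∷ ys) w≤x w≤ys = ∧-greatest (w≤ys (here ≡.refl)) (⋀-greatest ys w≤x (w≤ys ∘ there))

  module Joins (⊥ : Carrier) (⊥-minimum : Minimum _≤_ ⊥) where

    ⋁ : List Carrier → Carrier
    ⋁ = foldr _∨_ ⊥

    ⋁-upperBound : y ∈ ys → y ≤ ⋁ ys
    ⋁-upperBound (here ≡.refl) = x≤x∨y _ _
    ⋁-upperBound (there y∈ys) = trans (⋁-upperBound y∈ys) (y≤x∨y _ _)

    ⋁-least : ∀ ys → (∀ {y} → y ∈ ys → y ≤ w) → ⋁ ys ≤ w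
    ⋁-least {w} [] _ = ⊥-minimum w
    ⋁-least (y ∷ ys) ys≤w = ∨-least (ys≤w (here ≡.refl)) (⋁-least ys (ys≤w ∘ there))

    ⋁-prime : ∀ ys → IsJoinIrreducible j → j ≤ ⋁ ys → ∃[ y ] y ∈ ys × j ≤ y
    ⋁-prime [] (j≱ , _) j≤⊥ = ⊥-elim (j≱ (trans j≤⊥ ∘ ⊥-minimum))
    ⋁-prime (y ∷ ys) J j≤⋁ with joinIrreducible-prime J j≤⋁
    ... | inj₁ j≤y = y , here ≡.refl , j≤y
    ... | inj₂ j≤⋁ys with ⋁-prime ys J j≤⋁ys
    ...   | z , z∈ys , j≤z = z , there z∈ys , j≤z

  Maximal : Pred Carrier p → Pred Carrier _
  Maximal P m = P m × (∀ {k} → P k → m ≤ k → k ≤ m)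

  maximal-resp-≈ : P Respects _≈_ → Maximal P Respects _≈_
  maximal-resp-≈ resp m≈n (Pm , m-max) =
    resp m≈n Pm ,
    λ Pk n≤k → trans (m-max Pk (trans (reflexive m≈n) n≤k)) (reflexive m≈n)

  JoinIrreducibleBelow : Carrier → Pred Carrier _
  JoinIrreducibleBelow x j = IsJoinIrreducible j × j ≤ x

  joinIrreducibleBelow-resp-≈ : JoinIrreducibleBelow x Respects _≈_
  joinIrreducibleBelow-resp-≈ j≈k (J , j≤x) =
    joinIrreducible-resp-≈ j≈k J , ≤-respˡ-≈ j≈k j≤x

  MaximalJoinIrreducibleBelow : Carrier → Pred Carrier _
  MaximalJoinIrreducibleBelow x = Maximal (JoinIrreducibleBelow x)

  maximalJoinIrreducibleBelow-resp-≈ : MaximalJoinIrreducibleBelow x Respects _≈_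
  maximalJoinIrreducibleBelow-resp-≈ = maximal-resp-≈ joinIrreducibleBelow-resp-≈

  maximalJoinIrreducibleBelow-cong : x ≈ y → MaximalJoinIrreducibleBelow x j → MaximalJoinIrreducibleBelow y j
  maximalJoinIrreducibleBelow-cong x≈y ((J , j≤x) , j-max) =
    (J , ≤-respʳ-≈ x≈y j≤x) , λ (K , k≤y) → j-max (K , ≤-respʳ-≈ (Eq.sym x≈y) k≤y)

  joinIrreducible⇒maximalBelowItself : IsJoinIrreducible j → MaximalJoinIrreducibleBelow j j
  joinIrreducible⇒maximalBelowItself J = (J , refl) , λ (_ , k≤j) _ → k≤j

  JoinIrreduciblesFormAntichain : Set _
  JoinIrreduciblesFormAntichain = ∀ {a b} → IsJoinIrreducible a → IsJoinIrreducible b → a ≤ b → a ≈ b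

  module PowerSet {k} {f : Carrier → Subset k} (f-iso : IsOrderIsomorphism _≈_ _≡_ _≤_ _⊆_ f) where
    open IsOrderIsomorphism f-iso

    _∖_ : Carrier → Carrier → Carrier
    b ∖ a = proj₁ (surjective (f b ∩ ∁ (f a)))

    f-∖ : ∀ b a → f (b ∖ a) ≡ f b ∩ ∁ (f a)
    f-∖ b a = proj₂ (surjective (f b ∩ ∁ (f a))) Eq.refl

    ∖-≤ : ∀ b a → b ∖ a ≤ b
    ∖-≤ b a = cancel λ t∈ → proj₁ (x∈p∩q⁻ (f b) _ (≡.subst (_ Subset.∈_) (f-∖ b a) t∈))

    ≤-∨-∖ : ∀ b a → b ≤ a ∨ b ∖ a
    ≤-∨-∖ b a = cancel b⊆
      where
      b⊆ : f b ⊆ f (a ∨ b ∖ a)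
      b⊆ {t} t∈fb with t ∈? f a
      ... | yes t∈fa = mono (x≤x∨y a _) t∈fa
      ... | no t∉fa =
        mono (y≤x∨y a _) (≡.subst (t Subset.∈_) (≡.sym (f-∖ b a)) (x∈p∩q⁺ (t∈fb , x∉p⇒x∈∁p t∉fa)))

    ≤-∖⇒minimum : ∀ b a → a ≤ b ∖ a → Minimum _≤_ a
    ≤-∖⇒minimum b a a≤b∖a _ = cancel λ t∈fa →
      ⊥-elim (x∈∁p⇒x∉p (proj₂ (x∈p∩q⁻ (f b) _ (≡.subst (_ Subset.∈_) (f-∖ b a) (mono a≤b∖a t∈fa)))) t∈fa)

  -- In a power set every join-irreducible is an atom, since b = a ∨ (b ∖ a) whenever a ≤ b.
  boolean⇒antichain : IsBoolean 𝓛 → JoinIrreduciblesFormAntichain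
  boolean⇒antichain (_ , _ , f-iso) {a} {b} (a≱ , _) (_ , b-irr) a≤b =
    [ Eq.sym , (λ b≈b∖a → ⊥-elim (a≱ (≤-∖⇒minimum b a (trans a≤b (reflexive b≈b∖a))))) ]
      (b-irr a (b ∖ a) (antisym (≤-∨-∖ b a) (∨-least a≤b (∖-≤ b a))))
    where open PowerSet f-iso

-- x₀ is only used to form ⊥ as the meet of all elements; the theorem fails for the empty lattice.
module FiniteDistributiveLattice {c ℓ₁ ℓ₂} (𝓛 : DistributiveLattice c ℓ₁ ℓ₂)
  (finite : IsFinite 𝓛) (x₀ : DistributiveLattice.Carrier 𝓛) where
  open DistributiveLattice 𝓛
  open PosetProperties poset using (_<_; <⇒≉; <⇒≱; ≤∧≉⇒<; <-respˡ-≈; <-resp-≈; ≰-respʳ-≈)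
  open DistributiveLatticeProperties 𝓛

  private
    variable
      p : Level
      P : Pred Carrier p
      j k x y w : Carrier

  n : ℕ
  n = proj₁ finite

  elementAt : Fin n → Carrier
  elementAt = proj₁ (proj₂ finite)

  elementAt-injective : ∀ {i i′} → elementAt i ≈ elementAt i′ → i ≡ i′
  elementAt-injective = proj₁ (proj₂ (proj₂ finite))

  positionOf : Carrier → Fin n
  positionOf x = proj₁ (proj₂ (proj₂ (proj₂ finite)) x)

  elementAt-positionOf : ∀ x → elementAt (positionOf x) ≈ x
  elementAt-positionOf x = proj₂ (proj₂ (proj₂ (proj₂ finite)) x) ≡.refl

  -- Decidability and well-foundedness

  _≈?_ : Decidable _≈_
  x ≈? y = map′
    (λ i≡i′ → Eq.trans (Eq.sym (elementAt-positionOf x))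
                (Eq.trans (Eq.reflexive (≡.cong elementAt i≡i′)) (elementAt-positionOf y)))
    (λ x≈y → elementAt-injective
                (Eq.trans (elementAt-positionOf x) (Eq.trans x≈y (Eq.sym (elementAt-positionOf y)))))
    (positionOf x Fin.≟ positionOf y)

  _≤?_ : Decidable _≤_
  _≤?_ = JoinSemilatticeProperties.≈-dec⇒≤-dec joinSemilattice _≈?_

  _<?_ : Decidable _<_
  x <? y = (x ≤? y) ×-dec ¬? (x ≈? y)

  ∃? : P Respects _≈_ → Decidable₁ P → Dec (∃ P)
  ∃? resp P? = map′
    (λ (i , Pi) → elementAt i , Pi)
    (λ (x , Px) → positionOf x , resp (Eq.sym (elementAt-positionOf x)) Px)
    (any? (P? ∘ elementAt))

  _⋖?_ : Decidable _⋖_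
  y ⋖? x = map′
    (λ (y<x , ∄between) → y<x , λ z y<z z<x → ∄between (z , y<z , z<x))
    (λ (y<x , nothing-between) → y<x , λ (z , y<z , z<x) → nothing-between z y<z z<x)
    ((y <? x) ×-dec ¬? (∃? between-resp (λ z → (y <? z) ×-dec (z <? x))))
    where
    between-resp : (λ z → y < z × z < x) Respects _≈_
    between-resp z≈w (y<z , z<x) = proj₁ <-resp-≈ z≈w y<z , <-respˡ-≈ z≈w z<x

  private
    <⇒<-positionOf : x < y → elementAt (positionOf x) < elementAt (positionOf y)
    <⇒<-positionOf {x} {y} =
      proj₂ <-resp-≈ (Eq.sym (elementAt-positionOf x)) ∘ proj₁ <-resp-≈ (Eq.sym (elementAt-positionOf y))

    isPartialOrderOnPositions : IsPartialOrder (λ i i′ → elementAt i ≈ elementAt i′) (λ i i′ → elementAt i ≤ elementAt i′)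
    isPartialOrderOnPositions = On.isPartialOrder elementAt isPartialOrder

  <-wellFounded : WellFounded _<_
  <-wellFounded = Subrelation.wellFounded <⇒<-positionOf
    (On.wellFounded positionOf (po-wellFounded isPartialOrderOnPositions))

  >-wellFounded : WellFounded (flip _<_)
  >-wellFounded = Subrelation.wellFounded <⇒<-positionOf
    (On.wellFounded positionOf (po-noetherian isPartialOrderOnPositions))

  elements : List Carrier
  elements = tabulate elementAt

  ∈-filter-elements : (P? : Decidable₁ P) → P Respects _≈_ → P x → elementAt (positionOf x) ∈ filter P? elements
  ∈-filter-elements {x = x} P? resp Px =
    ∈-filter⁺ P? (∈-tabulate⁺ (positionOf x)) (resp (Eq.sym (elementAt-positionOf x)) Px)

  ⊥ : Carrier
  ⊥ = ⋀ x₀ elements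

  ⊥-minimum : Minimum _≤_ ⊥
  ⊥-minimum x = ≤-respʳ-≈ (elementAt-positionOf x) (⋀-lowerBound x₀ (∈-tabulate⁺ (positionOf x)))

  open Joins ⊥ ⊥-minimum public

  ⋁[_] : Decidable₁ P → Carrier
  ⋁[ P? ] = ⋁ (filter P? elements)

  ⋁[]-upperBound : (P? : Decidable₁ P) → P Respects _≈_ → P x → x ≤ ⋁[ P? ]
  ⋁[]-upperBound {x = x} P? resp Px =
    ≤-respˡ-≈ (elementAt-positionOf x) (⋁-upperBound (∈-filter-elements P? resp Px))

  ⋁[]-least : (P? : Decidable₁ P) → (∀ {y} → P y → y ≤ w) → ⋁[ P? ] ≤ w
  ⋁[]-least P? P≤w = ⋁-least (filter P? elements) (P≤w ∘ proj₂ ∘ ∈-filter⁻ P? {xs = elements})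

  ⋁[]-prime : (P? : Decidable₁ P) → IsJoinIrreducible j → j ≤ ⋁[ P? ] → ∃[ y ] P y × j ≤ y
  ⋁[]-prime P? J j≤⋁ with ⋁-prime (filter P? elements) J j≤⋁
  ... | y , y∈ , j≤y = y , proj₂ (∈-filter⁻ P? {xs = elements} y∈) , j≤y

  module _ {P : Pred Carrier p} (resp : P Respects _≈_) (P? : Decidable₁ P) where

    private
      Above : Carrier → Pred Carrier _
      Above m k = P k × m < k

      above? : ∀ m → Dec (∃ (Above m))
      above? m = ∃? (λ k≈l (Pk , m<k) → resp k≈l Pk , proj₁ <-resp-≈ k≈l m<k) (λ k → P? k ×-dec m <? k)

      ∄above⇒maximal : ∀ {m} → P m → ¬ ∃ (Above m) → Maximal P m
      ∄above⇒maximal {m} Pm ∄above = Pm , λ {k} Pk m≤k →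
        decidable-stable (k ≤? m) λ k≰m → ∄above (k , Pk , m≤k , λ m≈k → k≰m (reflexive (Eq.sym m≈k)))

    maximal? : Decidable₁ (Maximal P)
    maximal? m = map′
      (λ (Pm , ∄above) → ∄above⇒maximal Pm ∄above)
      (λ (Pm , m-max) → Pm , λ (_ , Pk , m<k) → <⇒≱ m<k (m-max Pk (proj₁ m<k)))
      (P? m ×-dec ¬? (above? m))

    maximal-above : P x → ∃[ m ] Maximal P m × x ≤ m
    maximal-above = All.wfRec >-wellFounded _ (λ x → P x → ∃[ m ] Maximal P m × x ≤ m) step _
      where
      step : ∀ x → (∀ {y} → x < y → P y → ∃[ m ] Maximal P m × y ≤ m) → P x → ∃[ m ] Maximal P m × x ≤ m
      step x above-maximal Px with above? x
      ... | no ∄above = x , ∄above⇒maximal Px ∄above , refl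
      ... | yes (y , Py , x<y) with above-maximal x<y Py
      ...   | m , m-max , y≤m = m , m-max , trans (proj₁ x<y) y≤m

  -- Join-irreducibles and core labels

  ⇊ : Carrier → Carrier
  ⇊ x = ⋁[ (_<? x) ]

  ⇊-≤ : ∀ x → ⇊ x ≤ x
  ⇊-≤ x = ⋁[]-least (_<? x) proj₁

  <⇒≤⇊ : y < x → y ≤ ⇊ x
  <⇒≤⇊ {x = x} = ⋁[]-upperBound (_<? x) <-respˡ-≈

  ⇊≉⇒joinIrreducible : ¬ ⇊ x ≈ x → IsJoinIrreducible x
  ⇊≉⇒joinIrreducible {x} ⇊x≉x = x≱ , x-irr
    where
    x≱ : ¬ Minimum _≤_ x
    x≱ x-min = ⇊x≉x (antisym (⇊-≤ x) (x-min (⇊ x)))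
    x-irr : ∀ a b → x ≈ a ∨ b → x ≈ a ⊎ x ≈ b
    x-irr a b x≈a∨b with x ≈? a | x ≈? b
    ... | yes x≈a | _ = inj₁ x≈a
    ... | no _ | yes x≈b = inj₂ x≈b
    ... | no x≉a | no x≉b = ⊥-elim (⇊x≉x (antisym (⇊-≤ x) (trans (reflexive x≈a∨b) (∨-least
          (<⇒≤⇊ (≤∧≉⇒< (trans (x≤x∨y a b) (reflexive (Eq.sym x≈a∨b))) (x≉a ∘ Eq.sym)))
          (<⇒≤⇊ (≤∧≉⇒< (trans (y≤x∨y a b) (reflexive (Eq.sym x≈a∨b))) (x≉b ∘ Eq.sym)))))))

  ⇊⋖ : IsJoinIrreducible j → ⇊ j ⋖ j
  ⇊⋖ {j} J = ≤∧≉⇒< (⇊-≤ j) ⇊j≉j , λ z ⇊j<z z<j → <⇒≱ ⇊j<z (<⇒≤⇊ z<j)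
    where
    ⇊j≉j : ¬ ⇊ j ≈ j
    ⇊j≉j ⇊j≈j with ⋁[]-prime (_<? j) J (reflexive (Eq.sym ⇊j≈j))
    ... | y , y<j , j≤y = <⇒≱ y<j j≤y

  joinIrreducible? : Decidable₁ IsJoinIrreducible
  joinIrreducible? x = map′ ⇊≉⇒joinIrreducible (λ J → <⇒≉ (proj₁ (⇊⋖ J))) (¬? (⇊ x ≈? x))

  -- If x is not join-irreducible, it is the join ⇊ x of the elements strictly below it.
  ≤-byJoinIrreducibles : (∀ {k} → IsJoinIrreducible k → k ≤ x → k ≤ w) → x ≤ w
  ≤-byJoinIrreducibles {x} {w} =
    All.wfRec <-wellFounded _ (λ x → (∀ {k} → IsJoinIrreducible k → k ≤ x → k ≤ w) → x ≤ w) step x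
    where
    step : ∀ x → (∀ {y} → y < x → (∀ {k} → IsJoinIrreducible k → k ≤ y → k ≤ w) → y ≤ w) →
           (∀ {k} → IsJoinIrreducible k → k ≤ x → k ≤ w) → x ≤ w
    step x below-≤ JI≤w with ⇊ x ≈? x
    ... | no ⇊x≉x = JI≤w (⇊≉⇒joinIrreducible ⇊x≉x) refl
    ... | yes ⇊x≈x = trans (reflexive (Eq.sym ⇊x≈x))
      (⋁[]-least (_<? x) λ y<x → below-≤ y<x λ K k≤y → JI≤w K (trans k≤y (proj₁ y<x)))

  ⋖-∨ : y ⋖ x → w ≤ x → ¬ w ≤ y → y ∨ w ≈ x
  ⋖-∨ {y} {x} {w} (y<x , nothing-between) w≤x w≰y = decidable-stable ((y ∨ w) ≈? x) λ y∨w≉x →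
    nothing-between (y ∨ w)
      (≤∧≉⇒< (x≤x∨y y w) λ y≈y∨w → w≰y (trans (y≤x∨y y w) (reflexive (Eq.sym y≈y∨w))))
      (≤∧≉⇒< (∨-least (proj₁ y<x) w≤x) y∨w≉x)

  nucleus : Carrier → Carrier
  nucleus x = ⋀ x (filter (_⋖? x) elements)

  nucleus-isNucleus : ∀ x → D.IsNucleus 𝓛 x (nucleus x)
  nucleus-isNucleus x =
    ⋀-≤ x (filter (_⋖? x) elements) ,
    (λ y y⋖x → ≤-respʳ-≈ (elementAt-positionOf y)
                 (⋀-lowerBound x (∈-filter-elements (_⋖? x) ⋖-resp-≈ˡ y⋖x))) ,
    λ w w≤x w≤covers → ⋀-greatest _ w≤x (λ y∈ → w≤covers _ (proj₂ (∈-filter⁻ (_⋖? x) {xs = elements} y∈)))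

  Ψ⇒maximal : Ψ x j → MaximalJoinIrreducibleBelow x j
  Ψ⇒maximal {x} {j} (z , (_ , _ , z-greatest) , u , v , z≤u , _ , v≤x , J , j* , (j*<j , _) , persp) =
    (J , j≤x) , j-max
    where
    j≤v×j≰u : j ≤ v × ¬ j ≤ u
    j≤v×j≰u = perspective⇒≤∧≰ j*<j J persp
    j≤x : j ≤ x
    j≤x = trans (proj₁ j≤v×j≰u) v≤x
    -- For k ≰ j, every lower cover y of x is above j: otherwise y ∨ j = x gives k ≤ y.
    j-max : ∀ {k} → JoinIrreducibleBelow x k → j ≤ k → k ≤ j
    j-max {k} (K , k≤x) j≤k = decidable-stable (k ≤? j) λ k≰j →
      proj₂ j≤v×j≰u (trans (z-greatest j j≤x (λ _ y⋖x → below-cover y⋖x k≰j)) z≤u)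
      where
      below-cover : ∀ {y} → y ⋖ x → ¬ k ≤ j → j ≤ y
      below-cover {y} y⋖x k≰j = decidable-stable (j ≤? y) λ j≰y →
        [ (λ k≤y → j≰y (trans j≤k k≤y)) , k≰j ]
          (joinIrreducible-prime K (≤-respʳ-≈ (Eq.sym (⋖-∨ y⋖x j≤x j≰y)) k≤x))

  downAvoiding : Carrier → Carrier → Carrier
  downAvoiding x j = ⋁[ (λ y → (y ≤? x) ×-dec ¬? (j ≤? y)) ]

  downAvoiding-≤ : ∀ x j → downAvoiding x j ≤ x
  downAvoiding-≤ x j = ⋁[]-least _ proj₁

  ≤-downAvoiding : y ≤ x → ¬ j ≤ y → y ≤ downAvoiding x j
  ≤-downAvoiding y≤x j≰y = ⋁[]-upperBound _
    (λ y≈z (y≤x , j≰y) → ≤-respˡ-≈ y≈z y≤x , ≰-respʳ-≈ y≈z j≰y) (y≤x , j≰y)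

  ≱-downAvoiding : IsJoinIrreducible j → ¬ j ≤ downAvoiding x j
  ≱-downAvoiding J j≤u with ⋁[]-prime _ J j≤u
  ... | _ , (_ , j≰y) , j≤y = j≰y j≤y

  ≤-∨-downAvoiding : MaximalJoinIrreducibleBelow x j → x ≤ j ∨ downAvoiding x j
  ≤-∨-downAvoiding {x} {j} (_ , j-max) = ≤-byJoinIrreducibles k≤j∨u
    where
    k≤j∨u : ∀ {k} → IsJoinIrreducible k → k ≤ x → k ≤ j ∨ downAvoiding x j
    k≤j∨u {k} K k≤x with j ≤? k
    ... | yes j≤k = trans (j-max (K , k≤x) j≤k) (x≤x∨y _ _)
    ... | no j≰k = trans (≤-downAvoiding k≤x j≰k) (y≤x∨y _ _)

  downAvoiding-⋖ : MaximalJoinIrreducibleBelow x j → downAvoiding x j ⋖ x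
  downAvoiding-⋖ {x} {j} j-max@((J , j≤x) , _) =
    ≤∧≉⇒< (downAvoiding-≤ x j) (λ u≈x → ≱-downAvoiding J (≤-respʳ-≈ (Eq.sym u≈x) j≤x)) ,
    nothing-between
    where
    nothing-between : ∀ w → downAvoiding x j < w → ¬ w < x
    nothing-between w u<w w<x with j ≤? w
    ... | yes j≤w = <⇒≱ w<x (trans (≤-∨-downAvoiding j-max) (∨-least j≤w (proj₁ u<w)))
    ... | no j≰w = <⇒≱ u<w (≤-downAvoiding (proj₁ w<x) j≰w)

  ∧-downAvoiding : MaximalJoinIrreducibleBelow x j → j ∧ downAvoiding x j ≈ ⇊ j
  ∧-downAvoiding {x} {j} ((J , j≤x) , _) = antisym
    (<⇒≤⇊ (≤∧≉⇒< (x∧y≤x j _) λ j∧u≈j → ≱-downAvoiding J (trans (reflexive (Eq.sym j∧u≈j)) (x∧y≤y j _))))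
    (∧-greatest (⇊-≤ j) (≤-downAvoiding (trans (⇊-≤ j) j≤x) (<⇒≱ (proj₁ (⇊⋖ J)))))

  -- The cover downAvoiding x j ⋖ x is perspective to ⇊ j ⋖ j.
  maximal⇒Ψ : MaximalJoinIrreducibleBelow x j → Ψ x j
  maximal⇒Ψ {x} {j} j-max@((J , j≤x) , _) =
    nucleus x , nucleus-isNucleus x ,
    downAvoiding x j , x , proj₁ (proj₂ (nucleus-isNucleus x)) _ (downAvoiding-⋖ j-max) ,
    downAvoiding-⋖ j-max , refl ,
    J , ⇊ j , ⇊⋖ J ,
    inj₁ (antisym (∨-least j≤x (downAvoiding-≤ x j)) (≤-∨-downAvoiding j-max) , ∧-downAvoiding j-max)

  -- The core label order

  maximalBelow? : ∀ x → Decidable₁ (MaximalJoinIrreducibleBelow x)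
  maximalBelow? x = maximal? joinIrreducibleBelow-resp-≈ (λ j → joinIrreducible? j ×-dec j ≤? x)

  infixr 7 _⊓_
  _⊓_ : Carrier → Carrier → Carrier
  x ⊓ y = ⋁[ (λ j → maximalBelow? x j ×-dec maximalBelow? y j) ]

  private
    bothMaximal-resp : (λ j → MaximalJoinIrreducibleBelow x j × MaximalJoinIrreducibleBelow y j) Respects _≈_
    bothMaximal-resp j≈k (x-max , y-max) =
      maximalJoinIrreducibleBelow-resp-≈ j≈k x-max , maximalJoinIrreducibleBelow-resp-≈ j≈k y-max

  ⊓-≤ˡ : ∀ x y → x ⊓ y ≤ x
  ⊓-≤ˡ x y = ⋁[]-least _ λ (((_ , k≤x) , _) , _) → k≤x

  maximal-⊓⁺ : MaximalJoinIrreducibleBelow x j → MaximalJoinIrreducibleBelow y j →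
               MaximalJoinIrreducibleBelow (x ⊓ y) j
  maximal-⊓⁺ {x} {j} {y} x-max@((J , _) , j-max) y-max =
    (J , ⋁[]-upperBound _ bothMaximal-resp (x-max , y-max)) ,
    λ (K , k≤x⊓y) → j-max (K , trans k≤x⊓y (⊓-≤ˡ x y))

  maximal-⊓⁻ : MaximalJoinIrreducibleBelow (x ⊓ y) j →
               MaximalJoinIrreducibleBelow x j × MaximalJoinIrreducibleBelow y j
  maximal-⊓⁻ {x} {y} {j} ((J , j≤x⊓y) , j-max) =
    let (m , m-max@(((M , _) , _) , _) , j≤m) = ⋁[]-prime _ J j≤x⊓y
    in bothMaximal-resp (antisym (j-max (M , ⋁[]-upperBound _ bothMaximal-resp m-max) j≤m) j≤m) m-max

  intersectionProperty : IntersectionProperty 𝓛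
  intersectionProperty x y = x ⊓ y , λ j →
    (λ (j∈Ψx , j∈Ψy) → maximal⇒Ψ (maximal-⊓⁺ (Ψ⇒maximal j∈Ψx) (Ψ⇒maximal j∈Ψy))) ,
    λ j∈Ψx⊓y → let (x-max , y-max) = maximal-⊓⁻ (Ψ⇒maximal j∈Ψx⊓y) in maximal⇒Ψ x-max , maximal⇒Ψ y-max

  ⊑⇒≤ : x ⊑ y → x ≤ y
  ⊑⇒≤ {x} {y} Ψx⊆Ψy = ≤-byJoinIrreducibles λ {k} K k≤x →
    let (m , m-max , k≤m) = maximal-above joinIrreducibleBelow-resp-≈ (λ j → joinIrreducible? j ×-dec j ≤? x) (K , k≤x)
    in trans k≤m (proj₂ (proj₁ (Ψ⇒maximal (Ψx⊆Ψy m (maximal⇒Ψ m-max)))))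

  ⊑-isPartialOrder : IsPartialOrder _≈_ _⊑_
  ⊑-isPartialOrder = record
    { isPreorder = record
      { isEquivalence = isEquivalence
      ; reflexive = λ x≈y j → maximal⇒Ψ ∘ maximalJoinIrreducibleBelow-cong x≈y ∘ Ψ⇒maximal
      ; trans = λ x⊑y y⊑z j → y⊑z j ∘ x⊑y j
      }
    ; antisym = λ x⊑y y⊑x → antisym (⊑⇒≤ x⊑y) (⊑⇒≤ y⊑x)
    }

  cloIsMeetSemilattice : CLOIsMeetSemilattice 𝓛
  cloIsMeetSemilattice = _⊓_ , record
    { isPartialOrder = ⊑-isPartialOrder
    ; infimum = λ x y →
      (λ j → proj₁ ∘ proj₂ (proj₂ (intersectionProperty x y) j)) ,
      (λ j → proj₂ ∘ proj₂ (proj₂ (intersectionProperty x y) j)) ,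
      λ z z⊑x z⊑y j j∈Ψz → proj₁ (proj₂ (intersectionProperty x y) j) (z⊑x j j∈Ψz , z⊑y j j∈Ψz)
    }

  cloIsLattice⇒antichain : CLOIsLattice 𝓛 → JoinIrreduciblesFormAntichain
  cloIsLattice⇒antichain (_⊔_ , _ , isLattice) {a} {b} A B a≤b =
    antisym a≤b (proj₂ (Ψ⇒maximal (a⊑a⊔b a (maximal⇒Ψ (joinIrreducible⇒maximalBelowItself A))))
                       (proj₁ (Ψ⇒maximal (b⊑a⊔b b (maximal⇒Ψ (joinIrreducible⇒maximalBelowItself B))))) a≤b)
    where
    a⊑a⊔b : a ⊑ (a ⊔ b)
    a⊑a⊔b = proj₁ (IsLattice.supremum isLattice a b)
    b⊑a⊔b : b ⊑ (a ⊔ b)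
    b⊑a⊔b = proj₁ (proj₂ (IsLattice.supremum isLattice a b))

  -- Antichains of join-irreducibles and power sets

  joinIrreducibles : List Carrier
  joinIrreducibles = filter joinIrreducible? elements

  #JI : ℕ
  #JI = length joinIrreducibles

  joinIrreducibleAt : Fin #JI → Carrier
  joinIrreducibleAt = lookup joinIrreducibles

  joinIrreducibleAt-isJoinIrreducible : ∀ t → IsJoinIrreducible (joinIrreducibleAt t)
  joinIrreducibleAt-isJoinIrreducible t = proj₂ (∈-filter⁻ joinIrreducible? {xs = elements} (∈-lookup t))

  joinIrreducibleAt-injective : ∀ {t t′} → joinIrreducibleAt t ≈ joinIrreducibleAt t′ → t ≡ t′
  joinIrreducibleAt-injective = lookup-injective setoid
    (Unique.filter⁺ setoid joinIrreducible? (Unique.tabulate⁺ setoid elementAt-injective))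

  joinIrreducibleAt-surjective : IsJoinIrreducible k → ∃[ t ] joinIrreducibleAt t ≈ k
  joinIrreducibleAt-surjective {k} K =
    index k∈ , Eq.trans (Eq.reflexive (≡.sym (lookup-index k∈))) (elementAt-positionOf k)
    where
    k∈ : elementAt (positionOf k) ∈ joinIrreducibles
    k∈ = ∈-filter-elements joinIrreducible? joinIrreducible-resp-≈ K

  joinIrreduciblesBelow : Carrier → Subset #JI
  joinIrreduciblesBelow x = Vec.tabulate λ t → does (joinIrreducibleAt t ≤? x)

  ∈-joinIrreduciblesBelow⁺ : ∀ {t} → joinIrreducibleAt t ≤ x → t Subset.∈ joinIrreduciblesBelow x
  ∈-joinIrreduciblesBelow⁺ {x} {t} t≤x = lookup⇒[]= t (joinIrreduciblesBelow x)
    (≡.trans (lookup∘tabulate _ t) (dec-true (joinIrreducibleAt t ≤? x) t≤x))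

  ∈-joinIrreduciblesBelow⁻ : ∀ {t} → t Subset.∈ joinIrreduciblesBelow x → joinIrreducibleAt t ≤ x
  ∈-joinIrreduciblesBelow⁻ {x} {t} t∈ = decidable-stable (joinIrreducibleAt t ≤? x) λ t≰x →
    contradiction (≡.trans (≡.sym (dec-false (joinIrreducibleAt t ≤? x) t≰x)) (≡.trans (≡.sym (lookup∘tabulate _ t)) ([]=⇒lookup t∈))) λ ()

  joinIrreduciblesBelow-mono : x ≤ y → joinIrreduciblesBelow x ⊆ joinIrreduciblesBelow y
  joinIrreduciblesBelow-mono x≤y t∈ = ∈-joinIrreduciblesBelow⁺ (trans (∈-joinIrreduciblesBelow⁻ t∈) x≤y)

  joinIrreduciblesBelow-cong : x ≈ y → joinIrreduciblesBelow x ≡ joinIrreduciblesBelow y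
  joinIrreduciblesBelow-cong x≈y =
    ⊆-antisym (joinIrreduciblesBelow-mono (reflexive x≈y)) (joinIrreduciblesBelow-mono (reflexive (Eq.sym x≈y)))

  joinIrreduciblesBelow-cancel : joinIrreduciblesBelow x ⊆ joinIrreduciblesBelow y → x ≤ y
  joinIrreduciblesBelow-cancel below⊆ = ≤-byJoinIrreducibles λ K k≤x →
    let (t , t≈k) = joinIrreducibleAt-surjective K
    in ≤-respˡ-≈ t≈k (∈-joinIrreduciblesBelow⁻ (below⊆ (∈-joinIrreduciblesBelow⁺ (≤-respˡ-≈ (Eq.sym t≈k) k≤x))))

  module _ (antichain : JoinIrreduciblesFormAntichain) where

    ≤⇒⊑ : x ≤ y → x ⊑ y
    ≤⇒⊑ x≤y j j∈Ψx with Ψ⇒maximal j∈Ψx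
    ... | (J , j≤x) , _ = maximal⇒Ψ ((J , trans j≤x x≤y) , λ (K , _) j≤k → reflexive (Eq.sym (antichain J K j≤k)))

    antichain⇒cloIsLattice : CLOIsLattice 𝓛
    antichain⇒cloIsLattice = _∨_ , _∧_ , record
      { isPartialOrder = ⊑-isPartialOrder
      ; supremum = λ x y → ≤⇒⊑ (x≤x∨y x y) , ≤⇒⊑ (y≤x∨y x y) ,
          λ z x⊑z y⊑z → ≤⇒⊑ (∨-least (⊑⇒≤ x⊑z) (⊑⇒≤ y⊑z))
      ; infimum = λ x y → ≤⇒⊑ (x∧y≤x x y) , ≤⇒⊑ (x∧y≤y x y) ,
          λ z z⊑x z⊑y → ≤⇒⊑ (∧-greatest (⊑⇒≤ z⊑x) (⊑⇒≤ z⊑y))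
      }

    joinOf : Subset #JI → Carrier
    joinOf S = ⋁ (map joinIrreducibleAt (filter (_∈? S) (allFin #JI)))

    joinIrreduciblesBelow-joinOf : ∀ S → joinIrreduciblesBelow (joinOf S) ≡ S
    joinIrreduciblesBelow-joinOf S = ⊆-antisym below⊆S S⊆below
      where
      S⊆below : S ⊆ joinIrreduciblesBelow (joinOf S)
      S⊆below {t} t∈S = ∈-joinIrreduciblesBelow⁺
        (⋁-upperBound (∈-map∘filter⁺ joinIrreducibleAt (_∈? S) (t , ∈-allFin t , ≡.refl , t∈S)))
      below⊆S : joinIrreduciblesBelow (joinOf S) ⊆ S
      below⊆S {t} t∈ =
        let (_ , y∈ , t≤y) = ⋁-prime _ (joinIrreducibleAt-isJoinIrreducible t) (∈-joinIrreduciblesBelow⁻ t∈)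
            (t′ , _ , y≡t′ , t′∈S) = ∈-map∘filter⁻ joinIrreducibleAt (_∈? S) {xs = allFin #JI} y∈
            t≈t′ = antichain (joinIrreducibleAt-isJoinIrreducible t) (joinIrreducibleAt-isJoinIrreducible t′)
                     (≤-respʳ-≈ (Eq.reflexive y≡t′) t≤y)
        in ≡.subst (Subset._∈ S) (≡.sym (joinIrreducibleAt-injective t≈t′)) t′∈S

    antichain⇒boolean : IsBoolean 𝓛
    antichain⇒boolean = #JI , joinIrreduciblesBelow , record
      { isOrderMonomorphism = record
        { isOrderHomomorphism = record
          { cong = joinIrreduciblesBelow-cong
          ; mono = joinIrreduciblesBelow-mono
          }
        ; injective = λ eq → antisym (joinIrreduciblesBelow-cancel (⊆-reflexive eq))
                                     (joinIrreduciblesBelow-cancel (⊆-reflexive (≡.sym eq)))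
        ; cancel = joinIrreduciblesBelow-cancel
        }
      ; surjective = λ S → joinOf S , λ z≈ → ≡.trans (joinIrreduciblesBelow-cong z≈) (joinIrreduciblesBelow-joinOf S)
      }

theorem1p2 : ∀ {c ℓ₁ ℓ₂} (𝓛 : DistributiveLattice c ℓ₁ ℓ₂) →
    IsFinite 𝓛 → DistributiveLattice.Carrier 𝓛 →
    IntersectionProperty 𝓛 × CLOIsMeetSemilattice 𝓛 ×
      (CLOIsLattice 𝓛 ⇔ IsBoolean 𝓛)
theorem1p2 𝓛 finite x₀ =
  intersectionProperty ,
  cloIsMeetSemilattice ,
  mk⇔ (antichain⇒boolean ∘ cloIsLattice⇒antichain) (antichain⇒cloIsLattice ∘ boolean⇒antichain)
  where
  open DistributiveLatticeProperties 𝓛 using (boolean⇒antichain)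
  open FiniteDistributiveLattice 𝓛 finite x₀
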